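{- For every integer $n \geq 1$ and all real numbers $a, b$ with $a \neq b$, \[ c^V_{a,b}(n) = (b-a)^{n-1}\, s_{a/(b-a)}(n). \]
   Context: A Schröder tree is a plane (ordered) rooted tree in which every internal node (non-leaf) has at least two children; the single-node tree has one leaf and no internal nodes. Let $s(n,k)$ be the number of Schröder trees with $n$ leaves and $k$ internal nodes, and for real $d$ let $s_d(n) = \sum_{k=0}^{n-1} s(n,k) d^k$ (convention $0^0=1$). Let $\mathcal{D}_n$ be the set of Dyck paths from $(0,0)$ to $(2n-2,0)$, i.e. lattice paths with steps $U=(1,1)$ and $D=(1,-1)$ never going below the $x$-axis (for $n=1$, only the empty path). For $P \in \mathcal{D}_n$, a valley is an occurrence of two consecutive steps $DU$; $V(P)$ is the number of valleys of $P$, and $U_V(P)$ is the number of up steps of $P$ that are not the $U$ of a valley. For real $a,b$, define $c^V_{a,b}(n) = \sum_{P \in \mathcal{D}_n} a^{U_V(P)} b^{V(P)}$ (convention $0^0=1$). -}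

module Defs where

open import Level using (Level)
open import Data.Nat as ℕ using (ℕ; zero; suc; _∸_)
open import Data.Bool using (Bool; true; false; if_then_else_)
open import Data.List using (List; []; _∷_; length; filterᵇ; foldr; upTo)
open import Data.List.Relation.Unary.All using (All)
open import Data.List.Membership.Propositional using (_∈_)
open import Data.List.Relation.Unary.Unique.Propositional using (Unique)
open import Data.Product using (_×_)
open import Data.Empty using (⊥)
open import Data.Unit using (⊤)
open import Relation.Binary.PropositionalEquality using (_≡_)
open import Algebra.Bundles using (CommutativeRing; Semiring)
import Algebra.Definitions.RawSemiring as RS

record Enumeration {A : Set} (P : A → Set) : Set where
  field
    elems    : List A
    sound    : All P elems
    complete : ∀ x → P x → x ∈ elems
    unique   : Unique elems
open Enumeration public

data Tree : Set where
  node : List Tree → Tree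

mutual
  leaves : Tree → ℕ
  leaves (node []) = 1
  leaves (node (t ∷ ts)) = leavesF (t ∷ ts)

  leavesF : List Tree → ℕ
  leavesF [] = 0
  leavesF (t ∷ ts) = leaves t ℕ.+ leavesF ts

mutual
  internal : Tree → ℕ
  internal (node []) = 0
  internal (node (t ∷ ts)) = suc (internalF (t ∷ ts))

  internalF : List Tree → ℕ
  internalF [] = 0
  internalF (t ∷ ts) = internal t ℕ.+ internalF ts

mutual
  IsSchroeder : Tree → Set
  IsSchroeder (node []) = ⊤
  IsSchroeder (node (t ∷ [])) = ⊥
  IsSchroeder (node (t ∷ u ∷ ts)) = AllSchroeder (t ∷ u ∷ ts)

  AllSchroeder : List Tree → Set
  AllSchroeder [] = ⊤
  AllSchroeder (t ∷ ts) = IsSchroeder t × AllSchroeder ts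

SchroederTree : ℕ → Tree → Set
SchroederTree n t = IsSchroeder t × leaves t ≡ n

s : ∀ n → Enumeration (SchroederTree n) → ℕ → ℕ
s n E k = length (filterᵇ (λ t → internal t ℕ.≡ᵇ k) (elems E))

data Step : Set where
  U D : Step

-- path starting at height h stays ≥ 0 and ends at height 0
DyckFrom : ℕ → List Step → Set
DyckFrom zero [] = ⊤
DyckFrom (suc h) [] = ⊥
DyckFrom h (U ∷ p) = DyckFrom (suc h) p
DyckFrom zero (D ∷ p) = ⊥
DyckFrom (suc h) (D ∷ p) = DyckFrom h p

DyckPath : ℕ → List Step → Set
DyckPath n p = length p ≡ 2 ℕ.* (n ∸ 1) × DyckFrom 0 p

valleys : List Step → ℕ
valleys [] = 0
valleys (D ∷ U ∷ p) = suc (valleys (U ∷ p))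
valleys (_ ∷ p) = valleys p

-- number of up steps that are not the U of a valley
-- (upsNV b p: b = true iff the step immediately preceding p is D)
upsNV : Bool → List Step → ℕ
upsNV _ [] = 0
upsNV true (U ∷ p) = upsNV false p
upsNV false (U ∷ p) = suc (upsNV false p)
upsNV _ (D ∷ p) = upsNV true p

UV : List Step → ℕ
UV p = upsNV false p

module _ {c ℓ : Level} (R : CommutativeRing c ℓ) where
  open CommutativeRing R
  open RS (Semiring.rawSemiring semiring) using (_^_) renaming (_×_ to _·ₙ_)

  pow : Carrier → ℕ → Carrier
  pow = _^_

  sd : ∀ n → Enumeration (SchroederTree n) → Carrier → Carrier
  sd n E d = foldr (λ k acc → (s n E k ·ₙ (d ^ k)) + acc) 0# (upTo n)

  cV : ∀ n → Enumeration (DyckPath n) → Carrier → Carrier → Carrier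
  cV n E a b = foldr (λ p acc → ((a ^ UV p) * (b ^ valleys p)) + acc) 0# (elems E)

module Submission where

-- Put c = b - a.  Weight a plane tree by a^(internal nodes) * c^(excess), the excess being
-- the sum of (arity - 2) over the internal nodes; since 1 + internal + excess = leaves, the
-- right-hand side is the total weight of the Schröder trees with n leaves.  A Dyck path
-- weighs a^U_V * b^V: every up step contributes a, or b when it follows a down step.
-- Cutting a Dyck path at its first return, U p D q, and a Schröder tree into its first
-- subtree and the tree r formed by the root with the other subtrees, gives two recurrences
-- of convolution shape.  In the tree recurrence r is attached either as one new child
-- (factor a) or, when r is internal, by merging its children into the root (factor c), so
-- r contributes a + c = b if it has at least two leaves and a otherwise.  In the path
-- recurrence q contributes a times its weight after a down step, which is b times its
-- weight when q is non-empty and a when q is empty.  So both sums satisfy the same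
-- recurrence.

open import Defs
open import Data.Nat as ℕ using (ℕ; zero; suc; _≤_; _<_; _∸_; s≤s; _≡ᵇ_)
import Data.Nat.Properties as ℕ
open import Data.Nat.Tactic.RingSolver using (solve-∀)
open import Data.Bool using (Bool; true; false; if_then_else_; T)
open import Data.List using (List; []; _∷_; [_]; _++_; length; map; concatMap; foldr; filterᵇ; upTo)
open import Data.List.Properties using (length-++; ++-cancelˡ; ∷-injective; ∷-injectiveʳ; foldr-map)
open import Data.List.Membership.Propositional using (_∈_; find; lose)
open import Data.List.Membership.Propositional.Properties
  using (∈-map⁺; ∈-map⁻; ∈-upTo⁺; ∈-upTo⁻; ∈-concatMap⁺; ∈-concatMap⁻)
open import Data.List.Membership.Propositional.Properties.WithK using (unique∧set⇒bag)
open import Data.List.Relation.Unary.Any using (here; there)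
open import Data.List.Relation.Unary.All as All using (All; []; _∷_)
open import Data.List.Relation.Unary.AllPairs using ([]; _∷_)
open import Data.List.Relation.Unary.Unique.Propositional using (Unique)
import Data.List.Relation.Unary.Unique.Propositional.Properties as Unique
open import Data.List.Relation.Binary.Permutation.Propositional using (_↭_; ↭⇒↭ₛ′)
open import Data.List.Relation.Binary.Permutation.Propositional.Properties using (map⁺)
open import Data.List.Relation.Binary.BagAndSetEquality using (∼bag⇒↭)
open import Data.Product using (∃; ∃₂; _×_; _,_; proj₁; proj₂)
open import Data.Unit using (tt)
open import Data.Empty using (⊥-elim)
open import Function.Bundles using (mk⇔)
open import Relation.Nullary using (contradiction)
open import Relation.Binary.PropositionalEquality as ≡ using (_≡_; _≢_)
open import Algebra.Bundles using (CommutativeRing; Semiring)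

module Combinatorics where

  open import Data.Nat using (_+_; _*_)
  open import Data.Nat.Properties
    using ( suc-injective; 1+n≢0; +-identityʳ; +-suc; *-suc; +-cancelˡ-≡; *-cancelˡ-≡
          ; m≤m+n; m≤n+m; ≤-<-trans; ≤-pred; m+n∸m≡n; m+[n∸m]≡n )
  open import Relation.Binary.PropositionalEquality
    using (refl; sym; trans; cong; cong₂; subst; module ≡-Reasoning)

  private
    variable
      A B C : Set

  ∈-concatMap⁺′ : ∀ (g : A → List B) {xs x y} → x ∈ xs → y ∈ g x → y ∈ concatMap g xs
  ∈-concatMap⁺′ g x∈ y∈ = ∈-concatMap⁺ g (lose x∈ y∈)

  ∈-concatMap⁻′ : ∀ (g : A → List B) xs {y} → y ∈ concatMap g xs → ∃ λ x → x ∈ xs × y ∈ g x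
  ∈-concatMap⁻′ g xs y∈ = find (∈-concatMap⁻ g y∈)

  concatMap-unique : ∀ (g : A → List B) {xs} → Unique xs → (∀ {x} → x ∈ xs → Unique (g x)) →
    (∀ {x x′ y} → x ∈ xs → x′ ∈ xs → y ∈ g x → y ∈ g x′ → x ≡ x′) →
    Unique (concatMap g xs)
  concatMap-unique g {[]}     _            _  _     = []
  concatMap-unique g {x ∷ xs} (x∉xs ∷ xs!) g! g-inj =
    Unique.++⁺ (g! (here refl))
      (concatMap-unique g xs! (λ x∈ → g! (there x∈)) (λ x∈ x′∈ → g-inj (there x∈) (there x′∈)))
      λ (y∈gx , y∈rest) → let x′ , x′∈xs , y∈gx′ = ∈-concatMap⁻′ g xs y∈rest in
        All.lookup x∉xs x′∈xs (g-inj (here refl) (there x′∈xs) y∈gx y∈gx′)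

  +≡⇒≤ˡ : ∀ {i j m} → i + j ≡ m → i ≤ m
  +≡⇒≤ˡ {i} {j} refl = m≤m+n i j

  +≡⇒≤ʳ : ∀ {i j m} → i + j ≡ m → j ≤ m
  +≡⇒≤ʳ {i} {j} refl = m≤n+m j i

  antidiagonal : ℕ → List (ℕ × ℕ)
  antidiagonal m = map (λ i → i , m ∸ i) (upTo (suc m))

  ∈-antidiagonal⁺ : ∀ {i j m} → i + j ≡ m → (i , j) ∈ antidiagonal m
  ∈-antidiagonal⁺ {i} {j} refl =
    subst (_∈ antidiagonal (i + j)) (cong (i ,_) (m+n∸m≡n i j))
      (∈-map⁺ _ (∈-upTo⁺ (s≤s (m≤m+n i j))))

  ∈-antidiagonal⁻ : ∀ {i j m} → (i , j) ∈ antidiagonal m → i + j ≡ m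
  ∈-antidiagonal⁻ ij∈ with ∈-map⁻ _ ij∈
  ... | _ , i∈ , refl = m+[n∸m]≡n (≤-pred (∈-upTo⁻ i∈))

  antidiagonal-unique : ∀ m → Unique (antidiagonal m)
  antidiagonal-unique m = Unique.map⁺ (cong proj₁) (Unique.upTo⁺ (suc m))

  antidiagonal-proj₁-injective : ∀ {m i i′ j j′} → (i , j) ∈ antidiagonal m →
    (i′ , j′) ∈ antidiagonal m → i ≡ i′ → (i , j) ≡ (i′ , j′)
  antidiagonal-proj₁-injective {i = i} ij∈ ij′∈ refl =
    cong (i ,_) (+-cancelˡ-≡ i _ _ (trans (∈-antidiagonal⁻ ij∈) (sym (∈-antidiagonal⁻ ij′∈))))

  pairsWith : (A → B → List C) → List A → List B → List C
  pairsWith h xs ys = concatMap (λ x → concatMap (h x) ys) xs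

  module _ (h : A → B → List C) {xs : List A} {ys : List B} where

    ∈-pairsWith⁺ : ∀ {x y c} → x ∈ xs → y ∈ ys → c ∈ h x y → c ∈ pairsWith h xs ys
    ∈-pairsWith⁺ x∈ y∈ c∈ = ∈-concatMap⁺′ _ x∈ (∈-concatMap⁺′ (h _) y∈ c∈)

    ∈-pairsWith⁻ : ∀ {c} → c ∈ pairsWith h xs ys → ∃₂ λ x y → x ∈ xs × y ∈ ys × c ∈ h x y
    ∈-pairsWith⁻ c∈ with ∈-concatMap⁻′ _ xs c∈
    ... | x , x∈ , c∈′ with ∈-concatMap⁻′ (h x) ys c∈′
    ... | y , y∈ , c∈″ = x , y , x∈ , y∈ , c∈″

    pairsWith-unique : Unique xs → Unique ys → (∀ x y → Unique (h x y)) →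
      (∀ {x x′ y y′ c} → x ∈ xs → x′ ∈ xs → c ∈ h x y → c ∈ h x′ y′ → x ≡ x′ × y ≡ y′) →
      Unique (pairsWith h xs ys)
    pairsWith-unique xs! ys! h! h-inj =
      concatMap-unique _ xs!
        (λ x∈ → concatMap-unique (h _) ys! (λ _ → h! _ _) λ _ _ c∈ c∈′ → proj₂ (h-inj x∈ x∈ c∈ c∈′))
        λ x∈ x′∈ c∈ c∈′ →
          let _ , _ , c∈h = ∈-concatMap⁻′ (h _) ys c∈ ; _ , _ , c∈h′ = ∈-concatMap⁻′ (h _) ys c∈′ in
          proj₁ (h-inj x∈ x′∈ c∈h c∈h′)

  convolve : (ℕ → List A) → (ℕ → List B) → (A → B → List C) → ℕ → List C
  convolve F G h m = concatMap (λ (i , j) → pairsWith h (F i) (G j)) (antidiagonal m)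

  module _ (F : ℕ → List A) (G : ℕ → List B) (h : A → B → List C) where

    ∈-convolve⁺ : ∀ {i j m x y c} → i + j ≡ m → x ∈ F i → y ∈ G j → c ∈ h x y →
      c ∈ convolve F G h m
    ∈-convolve⁺ i+j≡m x∈ y∈ c∈ =
      ∈-concatMap⁺′ _ (∈-antidiagonal⁺ i+j≡m) (∈-pairsWith⁺ h x∈ y∈ c∈)

    ∈-convolve⁻ : ∀ {m c} → c ∈ convolve F G h m →
      ∃₂ λ i j → i + j ≡ m × ∃₂ λ x y → x ∈ F i × y ∈ G j × c ∈ h x y
    ∈-convolve⁻ {m} c∈ with ∈-concatMap⁻′ _ (antidiagonal m) c∈
    ... | (i , j) , ij∈ , c∈′ = i , j , ∈-antidiagonal⁻ ij∈ , ∈-pairsWith⁻ h c∈′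

    convolve-unique : (∀ i → Unique (F i)) → (∀ j → Unique (G j)) → (∀ x y → Unique (h x y)) →
      (∀ {i i′ x} → x ∈ F i → x ∈ F i′ → i ≡ i′) →
      (∀ {i i′ x x′ y y′ c} → x ∈ F i → x′ ∈ F i′ → c ∈ h x y → c ∈ h x′ y′ → x ≡ x′ × y ≡ y′) →
      ∀ m → Unique (convolve F G h m)
    convolve-unique F! G! h! F-size-injective h-inj m =
      concatMap-unique _ (antidiagonal-unique m)
        (λ {(i , j)} _ → pairsWith-unique h (F! i) (G! j) h! h-inj)
        λ {(i , j)} {(i′ , j′)} ij∈ ij′∈ c∈ c∈′ →
          let x , _ , x∈ , _ , c∈h = ∈-pairsWith⁻ h {F i} {G j} c∈
              _ , _ , x′∈ , _ , c∈h′ = ∈-pairsWith⁻ h {F i′} {G j′} c∈′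
              x≡x′ = proj₁ (h-inj x∈ x′∈ c∈h c∈h′)
          in antidiagonal-proj₁-injective ij∈ ij′∈
               (F-size-injective x∈ (subst (_∈ F i′) (sym x≡x′) x′∈))

  DyckFrom-++D : ∀ k h p q → DyckFrom k p → DyckFrom h q → DyckFrom (k + suc h) (p ++ D ∷ q)
  DyckFrom-++D zero    h []      q _  dq = dq
  DyckFrom-++D zero    h (U ∷ p) q dp dq = DyckFrom-++D 1 h p q dp dq
  DyckFrom-++D (suc k) h (U ∷ p) q dp dq = DyckFrom-++D (suc (suc k)) h p q dp dq
  DyckFrom-++D (suc k) h (D ∷ p) q dp dq = DyckFrom-++D k h p q dp dq

  DyckFrom-splitD : ∀ k h p → DyckFrom (k + suc h) p →
    ∃₂ λ p₁ p₂ → p ≡ p₁ ++ D ∷ p₂ × DyckFrom k p₁ × DyckFrom h p₂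
  DyckFrom-splitD zero    h (D ∷ p) dp = [] , p , refl , tt , dp
  DyckFrom-splitD zero    h (U ∷ p) dp with DyckFrom-splitD 1 h p dp
  ... | p₁ , p₂ , refl , d₁ , d₂ = U ∷ p₁ , p₂ , refl , d₁ , d₂
  DyckFrom-splitD (suc k) h (U ∷ p) dp with DyckFrom-splitD (suc (suc k)) h p dp
  ... | p₁ , p₂ , refl , d₁ , d₂ = U ∷ p₁ , p₂ , refl , d₁ , d₂
  DyckFrom-splitD (suc k) h (D ∷ p) dp with DyckFrom-splitD k h p dp
  ... | p₁ , p₂ , refl , d₁ , d₂ = D ∷ p₁ , p₂ , refl , d₁ , d₂

  DyckFrom-++D-injective : ∀ k p p′ {q q′} → DyckFrom k p → DyckFrom k p′ →
    p ++ D ∷ q ≡ p′ ++ D ∷ q′ → p ≡ p′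
  DyckFrom-++D-injective zero    []      []       _  _  _ = refl
  DyckFrom-++D-injective zero    (U ∷ p) (U ∷ p′) dp dp′ e =
    cong (U ∷_) (DyckFrom-++D-injective 1 p p′ dp dp′ (∷-injectiveʳ e))
  DyckFrom-++D-injective (suc k) (U ∷ p) (U ∷ p′) dp dp′ e =
    cong (U ∷_) (DyckFrom-++D-injective (suc (suc k)) p p′ dp dp′ (∷-injectiveʳ e))
  DyckFrom-++D-injective (suc k) (D ∷ p) (D ∷ p′) dp dp′ e =
    cong (D ∷_) (DyckFrom-++D-injective k p p′ dp dp′ (∷-injectiveʳ e))
  DyckFrom-++D-injective zero    []      (U ∷ _)  _  _  ()
  DyckFrom-++D-injective zero    (U ∷ _) []       _  _  ()
  DyckFrom-++D-injective (suc k) (U ∷ _) (D ∷ _)  _  _  ()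
  DyckFrom-++D-injective (suc k) (D ∷ _) (U ∷ _)  _  _  ()

  DyckFrom-even : ∀ k p → DyckFrom k p → ∃ λ j → k + length p ≡ 2 * j
  DyckFrom-even zero    []      _  = 0 , refl
  DyckFrom-even zero    (U ∷ p) dp = DyckFrom-even 1 p dp
  DyckFrom-even (suc k) (U ∷ p) dp with DyckFrom-even (suc (suc k)) p dp
  ... | j , e = j , trans (cong suc (+-suc k (length p))) e
  DyckFrom-even (suc k) (D ∷ p) dp with DyckFrom-even k p dp
  ... | j , e =
    suc j , trans (cong suc (+-suc k (length p))) (trans (cong (2 +_) e) (sym (*-suc 2 j)))

  firstReturn : List Step → List Step → List Step
  firstReturn p q = U ∷ p ++ D ∷ q

  firstReturn-length : ∀ p q → length (firstReturn p q) ≡ suc (length p + suc (length q))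
  firstReturn-length p q = cong suc (length-++ p)

  firstReturn-injective : ∀ {p p′ q q′} → DyckFrom 0 p → DyckFrom 0 p′ →
    firstReturn p q ≡ firstReturn p′ q′ → p ≡ p′ × q ≡ q′
  firstReturn-injective {p} dp dp′ e with DyckFrom-++D-injective 0 p _ dp dp′ (∷-injectiveʳ e)
  ... | refl = refl , ∷-injectiveʳ (++-cancelˡ p _ _ (∷-injectiveʳ e))

  firstReturns : List Step → List Step → List (List Step)
  firstReturns p q = [ firstReturn p q ]

  suc[2i+suc[2j]]≡2*suc[i+j] : ∀ i j → suc (2 * i + suc (2 * j)) ≡ 2 * suc (i + j)
  suc[2i+suc[2j]]≡2*suc[i+j] = solve-∀

  -- Dyck paths of semilength m (so of DyckPath (suc m)); f is recursion fuel, enough when m < f.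
  dyckPaths : ℕ → ℕ → List (List Step)
  dyckPaths _       zero    = [ [] ]
  dyckPaths zero    (suc m) = []
  dyckPaths (suc f) (suc m) = convolve (dyckPaths f) (dyckPaths f) firstReturns m

  dyckPaths-sound : ∀ f m {p} → p ∈ dyckPaths f m → DyckPath (suc m) p
  dyckPaths-sound _       zero    (here refl) = refl , tt
  dyckPaths-sound (suc f) (suc m) p∈
    with ∈-convolve⁻ (dyckPaths f) (dyckPaths f) firstReturns {m} p∈
  ... | i , j , refl , p , q , p∈′ , q∈ , here refl
    with dyckPaths-sound f i p∈′ | dyckPaths-sound f j q∈
  ... | lp , dp | lq , dq =
    trans (firstReturn-length p q)
      (trans (cong₂ (λ x y → suc (x + suc y)) lp lq) (suc[2i+suc[2j]]≡2*suc[i+j] i j)) ,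
    DyckFrom-++D 0 0 p q dp dq

  dyckPaths-complete : ∀ f m {p} → m < f → DyckPath (suc m) p → p ∈ dyckPaths f m
  dyckPaths-complete _       zero    {[]} _ _ = here refl
  dyckPaths-complete (suc f) (suc m) {U ∷ p} (s≤s m<f) (lp , dp)
    with DyckFrom-splitD 0 0 p dp
  ... | p₁ , p₂ , refl , d₁ , d₂ with DyckFrom-even 0 p₁ d₁ | DyckFrom-even 0 p₂ d₂
  ... | i , l₁ | j , l₂ =
    ∈-convolve⁺ (dyckPaths f) (dyckPaths f) firstReturns {i} {j} i+j≡m
      (dyckPaths-complete f i (≤-<-trans (+≡⇒≤ˡ i+j≡m) m<f) (l₁ , d₁))
      (dyckPaths-complete f j (≤-<-trans (+≡⇒≤ʳ {i} i+j≡m) m<f) (l₂ , d₂))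
      (here refl)
    where
    i+j≡m : i + j ≡ m
    i+j≡m = suc-injective (*-cancelˡ-≡ _ _ 2 (begin
      2 * suc (i + j)                       ≡⟨ suc[2i+suc[2j]]≡2*suc[i+j] i j ⟨
      suc (2 * i + suc (2 * j))             ≡⟨ cong₂ (λ x y → suc (x + suc y)) l₁ l₂ ⟨
      suc (length p₁ + suc (length p₂))     ≡⟨ firstReturn-length p₁ p₂ ⟨
      length (firstReturn p₁ p₂)            ≡⟨ lp ⟩
      2 * suc m                             ∎))
      where open ≡-Reasoning

  dyckPaths-unique : ∀ f m → Unique (dyckPaths f m)
  dyckPaths-unique _       zero    = [] ∷ []
  dyckPaths-unique zero    (suc m) = []
  dyckPaths-unique (suc f) (suc m) =
    convolve-unique (dyckPaths f) (dyckPaths f) firstReturns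
      (dyckPaths-unique f) (dyckPaths-unique f) (λ _ _ → [] ∷ [])
      (λ {i} {i′} p∈ p∈′ → *-cancelˡ-≡ _ _ 2
        (trans (sym (proj₁ (dyckPaths-sound f i p∈))) (proj₁ (dyckPaths-sound f i′ p∈′))))
      (λ {i} {i′} p∈ p′∈ → λ { (here refl) (here e) → firstReturn-injective
        (proj₂ (dyckPaths-sound f i p∈)) (proj₂ (dyckPaths-sound f i′ p′∈)) e })
      m

  mutual
    excess : Tree → ℕ
    excess (node [])       = 0
    excess (node (t ∷ ts)) = excessF (t ∷ ts) + (length ts ∸ 1)

    excessF : List Tree → ℕ
    excessF []       = 0
    excessF (t ∷ ts) = excess t + excessF ts

  mutual
    leaves-internal-excess : ∀ t → IsSchroeder t → suc (internal t + excess t) ≡ leaves t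
    leaves-internal-excess (node [])           _ = refl
    leaves-internal-excess (node (t ∷ u ∷ us)) h = begin
      suc (suc (IF + (EF + length us)))  ≡⟨ shuffle IF EF (length us) ⟩
      length (t ∷ u ∷ us) + (IF + EF)    ≡⟨ leavesF-internalF-excessF (t ∷ u ∷ us) h ⟩
      leavesF (t ∷ u ∷ us)               ∎
      where
      open ≡-Reasoning
      IF = internalF (t ∷ u ∷ us)
      EF = excessF (t ∷ u ∷ us)
      shuffle : ∀ i e l → suc (suc (i + (e + l))) ≡ 2 + l + (i + e)
      shuffle = solve-∀

    leavesF-internalF-excessF : ∀ ts → AllSchroeder ts →
      length ts + (internalF ts + excessF ts) ≡ leavesF ts
    leavesF-internalF-excessF []       _          = refl
    leavesF-internalF-excessF (t ∷ ts) (ht , hts) = begin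
      suc (length ts) + (internal t + internalF ts + (excess t + excessF ts))
        ≡⟨ shuffle (length ts) (internal t) (internalF ts) (excess t) (excessF ts) ⟩
      suc (internal t + excess t) + (length ts + (internalF ts + excessF ts))
        ≡⟨ cong₂ _+_ (leaves-internal-excess t ht) (leavesF-internalF-excessF ts hts) ⟩
      leaves t + leavesF ts ∎
      where
      open ≡-Reasoning
      shuffle : ∀ l i i′ e e′ → suc l + (i + i′ + (e + e′)) ≡ suc (i + e) + (l + (i′ + e′))
      shuffle = solve-∀

  spliced : Tree → List (List Tree)
  spliced (node (x ∷ y ∷ ys)) = [ x ∷ y ∷ ys ]
  spliced _                   = []

  -- The ways r can follow a first subtree as the rest of a root: as one further child, or,
  -- when r is internal, with its children spliced into the root.
  asSiblings : Tree → List (List Tree)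
  asSiblings r = [ r ] ∷ spliced r

  asSiblings-sound : ∀ t r {rs} → rs ∈ asSiblings r → IsSchroeder t → IsSchroeder r →
    IsSchroeder (node (t ∷ rs)) × leaves (node (t ∷ rs)) ≡ leaves t + leaves r
  asSiblings-sound t r (here refl) ht hr =
    (ht , hr , tt) , cong (leaves t +_) (+-identityʳ (leaves r))
  asSiblings-sound t (node (x ∷ y ∷ ys)) (there (here refl)) ht hr = (ht , hr) , refl

  asSiblings-injective : ∀ r r′ {rs} → rs ∈ asSiblings r → rs ∈ asSiblings r′ → r ≡ r′
  asSiblings-injective r r′ (here refl) (here refl) = refl
  asSiblings-injective (node (_ ∷ _ ∷ _)) (node (_ ∷ _ ∷ _))
    (there (here refl)) (there (here refl)) = refl
  asSiblings-injective r (node (_ ∷ _ ∷ _)) (here refl) (there (here ()))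
  asSiblings-injective (node (_ ∷ _ ∷ _)) r′ (there (here refl)) (here ())

  asSiblings-complete : ∀ y ys → AllSchroeder (y ∷ ys) → ∃ λ r →
    (y ∷ ys) ∈ asSiblings r × IsSchroeder r × leaves r ≡ leavesF (y ∷ ys)
  asSiblings-complete y []       (hy , _) = y , here refl , hy , sym (+-identityʳ (leaves y))
  asSiblings-complete y (z ∷ zs) hs       = node (y ∷ z ∷ zs) , there (here refl) , hs , refl

  graft : Tree → Tree → List Tree
  graft t r = map (λ rs → node (t ∷ rs)) (asSiblings r)

  -- Schröder trees with suc m leaves; f is recursion fuel, enough when m < f.
  schroederTrees : ℕ → ℕ → List Tree
  schroederTrees _       zero    = [ node [] ]
  schroederTrees zero    (suc m) = []
  schroederTrees (suc f) (suc m) = convolve (schroederTrees f) (schroederTrees f) graft m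

  schroederTrees-sound : ∀ f m {t} → t ∈ schroederTrees f m → SchroederTree (suc m) t
  schroederTrees-sound _       zero    (here refl) = tt , refl
  schroederTrees-sound (suc f) (suc m) c∈
    with ∈-convolve⁻ (schroederTrees f) (schroederTrees f) graft {m} c∈
  ... | i , j , refl , t , r , t∈ , r∈ , c∈′ with ∈-map⁻ _ c∈′
  ... | rs , rs∈ , refl with schroederTrees-sound f i t∈ | schroederTrees-sound f j r∈
  ... | ht , lt | hr , lr with asSiblings-sound t r rs∈ ht hr
  ... | hc , lc = hc , trans lc (trans (cong₂ _+_ lt lr) (cong suc (+-suc i j)))

  schroederTrees-complete : ∀ f m {t} → m < f → SchroederTree (suc m) t → t ∈ schroederTrees f m
  schroederTrees-complete _ zero {node []} _ _ = here refl
  schroederTrees-complete _ zero {node (x ∷ y ∷ ys)} _ (h , e) =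
    contradiction (suc-injective (trans (leaves-internal-excess (node (x ∷ y ∷ ys)) h) e)) 1+n≢0
  schroederTrees-complete (suc f) (suc m) {node (x ∷ y ∷ ys)} (s≤s m<f) ((hx , hys) , e)
    with asSiblings-complete y ys hys
  ... | r , ys∈ , hr , lr =
    ∈-convolve⁺ (schroederTrees f) (schroederTrees f) graft {i} {j} i+j≡m
      (schroederTrees-complete f i (≤-<-trans (+≡⇒≤ˡ i+j≡m) m<f)
        (hx , sym (leaves-internal-excess x hx)))
      (schroederTrees-complete f j (≤-<-trans (+≡⇒≤ʳ {i} i+j≡m) m<f)
        (hr , sym (leaves-internal-excess r hr)))
      (∈-map⁺ _ ys∈)
    where
    i = internal x + excess x
    j = internal r + excess r
    i+j≡m : i + j ≡ m
    i+j≡m = suc-injective (suc-injective (begin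
      suc (suc (i + j))           ≡⟨ cong suc (+-suc i j) ⟨
      suc i + suc j               ≡⟨ cong₂ _+_ (leaves-internal-excess x hx) (leaves-internal-excess r hr) ⟩
      leaves x + leaves r         ≡⟨ cong (leaves x +_) lr ⟩
      leaves (node (x ∷ y ∷ ys))  ≡⟨ e ⟩
      suc (suc m)                 ∎))
      where open ≡-Reasoning

  schroederTrees-unique : ∀ f m → Unique (schroederTrees f m)
  schroederTrees-unique _       zero    = [] ∷ []
  schroederTrees-unique zero    (suc m) = []
  schroederTrees-unique (suc f) (suc m) =
    convolve-unique (schroederTrees f) (schroederTrees f) graft
      (schroederTrees-unique f) (schroederTrees-unique f)
      (λ t r → Unique.map⁺ (λ e → proj₂ (∷-injective (node-injective e))) (asSiblings-unique r))
      (λ {i} {i′} t∈ t∈′ → suc-injective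
        (trans (sym (proj₂ (schroederTrees-sound f i t∈))) (proj₂ (schroederTrees-sound f i′ t∈′))))
      (λ _ _ → graft-injective)
      m
    where
    node-injective : ∀ {ts ts′} → node ts ≡ node ts′ → ts ≡ ts′
    node-injective refl = refl
    asSiblings-unique : ∀ r → Unique (asSiblings r)
    asSiblings-unique (node [])            = [] ∷ []
    asSiblings-unique (node (_ ∷ []))      = [] ∷ []
    asSiblings-unique (node (_ ∷ _ ∷ _))   = ((λ ()) ∷ []) ∷ [] ∷ []
    graft-injective : ∀ {t t′ r r′ c} → c ∈ graft t r → c ∈ graft t′ r′ → t ≡ t′ × r ≡ r′
    graft-injective {r = r} {r′} c∈ c∈′ with ∈-map⁻ _ c∈ | ∈-map⁻ _ c∈′
    ... | rs , rs∈ , refl | rs′ , rs′∈ , e with ∷-injective (node-injective e)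
    ... | refl , refl = refl , asSiblings-injective r r′ rs∈ rs′∈

open Combinatorics

module WeightedSums {r ℓ} (R : CommutativeRing r ℓ) where
  open CommutativeRing R
  open import Algebra.Definitions.RawSemiring (Semiring.rawSemiring semiring)
    using (_^_) renaming (_×_ to _·ₙ_)
  open import Algebra.Properties.Semiring.Exp semiring using (^-homo-*; ^-congˡ)
  open import Algebra.Properties.CommutativeSemiring.Exp commutativeSemiring using (^-distrib-*)
  open import Data.List.Relation.Binary.Permutation.Setoid.Properties setoid using (foldr-commMonoid)
  open import Algebra.Properties.CommutativeSemigroup +-commutativeSemigroup using (interchange)
  open import Algebra.Properties.CommutativeSemigroup *-commutativeSemigroup
    using (x∙yz≈y∙xz) renaming (interchange to *-interchange)
  import Algebra.Solver.CommutativeMonoid *-commutativeMonoid as *-Solver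
  open import Relation.Binary.Reasoning.Setoid setoid

  private
    variable
      A B C : Set

  ∑ : List A → (A → Carrier) → Carrier
  ∑ xs f = foldr (λ x acc → f x + acc) 0# xs

  syntax ∑ xs (λ x → e) = ∑[ x ← xs ] e

  ∑-cong : ∀ {f g : A → Carrier} xs → (∀ {x} → x ∈ xs → f x ≈ g x) → ∑ xs f ≈ ∑ xs g
  ∑-cong []       f≈g = refl
  ∑-cong (x ∷ xs) f≈g = +-cong (f≈g (here ≡.refl)) (∑-cong xs (λ x∈ → f≈g (there x∈)))

  ∑-++ : ∀ (f : A → Carrier) xs ys → ∑ (xs ++ ys) f ≈ ∑ xs f + ∑ ys f
  ∑-++ f []       ys = sym (+-identityˡ _)
  ∑-++ f (x ∷ xs) ys = trans (+-congˡ (∑-++ f xs ys)) (sym (+-assoc _ _ _))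

  ∑-concatMap : ∀ (f : B → Carrier) (g : A → List B) xs →
    ∑ (concatMap g xs) f ≈ ∑[ x ← xs ] ∑ (g x) f
  ∑-concatMap f g []       = refl
  ∑-concatMap f g (x ∷ xs) = trans (∑-++ f (g x) (concatMap g xs)) (+-congˡ (∑-concatMap f g xs))

  ∑-distribˡ : ∀ k (f : A → Carrier) xs → ∑[ x ← xs ] (k * f x) ≈ k * ∑ xs f
  ∑-distribˡ k f []       = sym (zeroʳ k)
  ∑-distribˡ k f (x ∷ xs) = trans (+-congˡ (∑-distribˡ k f xs)) (sym (distribˡ k _ _))

  ∑-distribʳ : ∀ k (f : A → Carrier) xs → ∑[ x ← xs ] (f x * k) ≈ ∑ xs f * k
  ∑-distribʳ k f xs =
    trans (∑-cong xs (λ {x} _ → *-comm (f x) k)) (trans (∑-distribˡ k f xs) (*-comm k _))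

  ∑-+ : ∀ (f g : A → Carrier) xs → ∑[ x ← xs ] (f x + g x) ≈ ∑ xs f + ∑ xs g
  ∑-+ f g []       = sym (+-identityˡ 0#)
  ∑-+ f g (x ∷ xs) = trans (+-congˡ (∑-+ f g xs)) (interchange _ _ _ _)

  ∑-zero : ∀ (xs : List A) → ∑[ x ← xs ] 0# ≈ 0#
  ∑-zero []       = refl
  ∑-zero (x ∷ xs) = trans (+-identityˡ _) (∑-zero xs)

  ∑-↭ : ∀ (f : A → Carrier) {xs ys} → xs ↭ ys → ∑ xs f ≈ ∑ ys f
  ∑-↭ f {xs} {ys} xs↭ys = begin
    ∑ xs f                   ≡⟨ foldr-map _+_ f 0# xs ⟨
    foldr _+_ 0# (map f xs)  ≈⟨ foldr-commMonoid +-isCommutativeMonoid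
                                  (↭⇒↭ₛ′ isEquivalence (map⁺ f xs↭ys)) ⟩
    foldr _+_ 0# (map f ys)  ≡⟨ foldr-map _+_ f 0# ys ⟩
    ∑ ys f                   ∎

  ∑-enumeration : ∀ {P : A → Set} (E : Enumeration P) {ys} (f : A → Carrier) →
    (∀ {y} → y ∈ ys → P y) → (∀ {y} → P y → y ∈ ys) → Unique ys → ∑ (elems E) f ≈ ∑ ys f
  ∑-enumeration E f ys-sound ys-complete ys! =
    ∑-↭ f (∼bag⇒↭ (unique∧set⇒bag (unique E) ys!
      (λ {x} → mk⇔ (λ x∈ → ys-complete (All.lookup (sound E) x∈)) (λ x∈ → complete E x (ys-sound x∈)))))

  ∑-pairsWith : ∀ (f : C → Carrier) (h : A → B → List C) (φ : A → Carrier) (ψ : B → Carrier) →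
    (∀ x y → ∑ (h x y) f ≈ φ x * ψ y) → ∀ xs ys → ∑ (pairsWith h xs ys) f ≈ ∑ xs φ * ∑ ys ψ
  ∑-pairsWith f h φ ψ ∑h≈φψ xs ys = begin
    ∑ (pairsWith h xs ys) f            ≈⟨ ∑-concatMap f _ xs ⟩
    ∑[ x ← xs ] ∑ (concatMap (h x) ys) f ≈⟨ ∑-cong xs (λ {x} _ → ∑-concatMap f (h x) ys) ⟩
    ∑[ x ← xs ] ∑[ y ← ys ] ∑ (h x y) f ≈⟨ ∑-cong xs (λ {x} _ → ∑-cong ys (λ {y} _ → ∑h≈φψ x y)) ⟩
    ∑[ x ← xs ] ∑[ y ← ys ] (φ x * ψ y) ≈⟨ ∑-cong xs (λ {x} _ → ∑-distribˡ (φ x) ψ ys) ⟩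
    ∑[ x ← xs ] (φ x * ∑ ys ψ)          ≈⟨ ∑-distribʳ (∑ ys ψ) φ xs ⟩
    ∑ xs φ * ∑ ys ψ                    ∎

  ∑-convolve : ∀ (f : C → Carrier) F G (h : A → B → List C) (φ : A → Carrier) (ψ : B → Carrier) →
    (∀ x y → ∑ (h x y) f ≈ φ x * ψ y) → ∀ m →
    ∑ (convolve F G h m) f ≈ ∑[ (i , j) ← antidiagonal m ] (∑ (F i) φ * ∑ (G j) ψ)
  ∑-convolve f F G h φ ψ ∑h≈φψ m =
    trans (∑-concatMap f (λ (i , j) → pairsWith h (F i) (G j)) (antidiagonal m))
      (∑-cong (antidiagonal m) (λ {(i , j)} _ → ∑-pairsWith f h φ ψ ∑h≈φψ (F i) (G j)))

  if-≡ᵇ-refl : ∀ n {y : Carrier} → (if n ≡ᵇ n then y else 0#) ≈ y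
  if-≡ᵇ-refl n with n ≡ᵇ n in eq
  ... | true  = refl
  ... | false = ⊥-elim (≡.subst T eq (ℕ.≡⇒≡ᵇ n n ≡.refl))

  if-≡ᵇ-≢ : ∀ {n k} {y : Carrier} → n ≢ k → (if n ≡ᵇ k then y else 0#) ≈ 0#
  if-≡ᵇ-≢ {n} {k} n≢k with n ≡ᵇ k in eq
  ... | true  = ⊥-elim (n≢k (ℕ.≡ᵇ⇒≡ n k (≡.subst T (≡.sym eq) tt)))
  ... | false = refl

  ∑-indicator-∉ : ∀ n ks (x : ℕ → Carrier) → All (n ≢_) ks →
    ∑[ k ← ks ] (if n ≡ᵇ k then x k else 0#) ≈ 0#
  ∑-indicator-∉ n ks x n∉ks = trans (∑-cong ks (λ k∈ → if-≡ᵇ-≢ (All.lookup n∉ks k∈))) (∑-zero ks)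

  ∑-indicator : ∀ n ks (x : ℕ → Carrier) → Unique ks → n ∈ ks →
    ∑[ k ← ks ] (if n ≡ᵇ k then x k else 0#) ≈ x n
  ∑-indicator n (n ∷ ks) x (n∉ks ∷ _) (here ≡.refl) =
    trans (+-cong (if-≡ᵇ-refl n) (∑-indicator-∉ n ks x n∉ks)) (+-identityʳ (x n))
  ∑-indicator n (k ∷ ks) x (k∉ks ∷ ks!) (there n∈ks) =
    trans (+-cong (if-≡ᵇ-≢ (λ n≡k → All.lookup k∉ks n∈ks (≡.sym n≡k))) (∑-indicator n ks x ks! n∈ks))
      (+-identityˡ (x n))

  length-filterᵇ-∷ : ∀ (p : A → Bool) t ts (y : Carrier) →
    length (filterᵇ p (t ∷ ts)) ·ₙ y ≈ (if p t then y else 0#) + length (filterᵇ p ts) ·ₙ y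
  length-filterᵇ-∷ p t ts y with p t
  ... | true  = refl
  ... | false = sym (+-identityˡ _)

  ∑-count : ∀ (g : A → ℕ) (x : ℕ → Carrier) ks → Unique ks → ∀ ts → All (λ t → g t ∈ ks) ts →
    ∑[ k ← ks ] (length (filterᵇ (λ t → g t ≡ᵇ k) ts) ·ₙ x k) ≈ ∑[ t ← ts ] x (g t)
  ∑-count g x ks ks! []       []             = ∑-zero ks
  ∑-count g x ks ks! (t ∷ ts) (gt∈ks ∷ gts∈) = begin
    ∑[ k ← ks ] (length (filterᵇ (λ t → g t ≡ᵇ k) (t ∷ ts)) ·ₙ x k)
      ≈⟨ ∑-cong ks (λ {k} _ → length-filterᵇ-∷ (λ t → g t ≡ᵇ k) t ts (x k)) ⟩
    ∑[ k ← ks ] ((if g t ≡ᵇ k then x k else 0#) + length (filterᵇ (λ t → g t ≡ᵇ k) ts) ·ₙ x k)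
      ≈⟨ ∑-+ _ _ ks ⟩
    ∑[ k ← ks ] (if g t ≡ᵇ k then x k else 0#)
      + ∑[ k ← ks ] (length (filterᵇ (λ t → g t ≡ᵇ k) ts) ·ₙ x k)
      ≈⟨ +-cong (∑-indicator (g t) ks x ks! gt∈ks) (∑-count g x ks ks! ts gts∈) ⟩
    x (g t) + ∑[ t ← ts ] x (g t) ∎

  module DyckWeight (a b : Carrier) where

    upWeight : Bool → Carrier
    upWeight false = a
    upWeight true  = b

    pathWeight : Bool → List Step → Carrier
    pathWeight _     []      = 1#
    pathWeight afterD (U ∷ p) = upWeight afterD * pathWeight false p
    pathWeight _     (D ∷ p) = pathWeight true p

    valleysAfter : Bool → List Step → ℕ
    valleysAfter false p = valleys p
    valleysAfter true  p = valleys (D ∷ p)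

    pathWeight-monomial : ∀ afterD p →
      a ^ upsNV afterD p * b ^ valleysAfter afterD p ≈ pathWeight afterD p
    pathWeight-monomial false []      = *-identityˡ 1#
    pathWeight-monomial true  []      = *-identityˡ 1#
    pathWeight-monomial false (U ∷ p) = trans (*-assoc _ _ _) (*-congˡ (pathWeight-monomial false p))
    pathWeight-monomial true  (U ∷ p) = trans (x∙yz≈y∙xz _ _ _) (*-congˡ (pathWeight-monomial false p))
    pathWeight-monomial false (D ∷ p) = pathWeight-monomial true p
    pathWeight-monomial true  (D ∷ p) = pathWeight-monomial true p

    pathWeight-++D : ∀ afterD p q →
      pathWeight afterD (p ++ D ∷ q) ≈ pathWeight afterD p * pathWeight true q
    pathWeight-++D _      []      q = sym (*-identityˡ _)
    pathWeight-++D afterD (U ∷ p) q = trans (*-congˡ (pathWeight-++D false p q)) (sym (*-assoc _ _ _))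
    pathWeight-++D _      (D ∷ p) q = pathWeight-++D true p q

    pathWeight-firstReturn : ∀ afterD p q → pathWeight afterD (firstReturn p q) ≈
      upWeight afterD * (pathWeight false p * pathWeight true q)
    pathWeight-firstReturn afterD p q = *-congˡ (pathWeight-++D false p q)

    dyckSum : ℕ → ℕ → Bool → Carrier
    dyckSum f m afterD = ∑ (dyckPaths f m) (pathWeight afterD)

    dyckSum-suc : ∀ f m afterD → dyckSum (suc f) (suc m) afterD ≈
      upWeight afterD * ∑[ (i , j) ← antidiagonal m ] (dyckSum f i false * dyckSum f j true)
    dyckSum-suc f m afterD = begin
      dyckSum (suc f) (suc m) afterD
        ≈⟨ ∑-convolve (pathWeight afterD) (dyckPaths f) (dyckPaths f) firstReturns
             (λ p → upWeight afterD * pathWeight false p) (pathWeight true)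
             (λ p q → trans (+-identityʳ _)
               (trans (pathWeight-firstReturn afterD p q) (sym (*-assoc _ _ _)))) m ⟩
      ∑[ (i , j) ← antidiagonal m ]
        (∑[ p ← dyckPaths f i ] (upWeight afterD * pathWeight false p) * dyckSum f j true)
        ≈⟨ ∑-cong (antidiagonal m) (λ {(i , j)} _ → trans
             (*-congʳ (∑-distribˡ (upWeight afterD) (pathWeight false) (dyckPaths f i)))
             (*-assoc _ _ _)) ⟩
      ∑[ (i , j) ← antidiagonal m ] (upWeight afterD * (dyckSum f i false * dyckSum f j true))
        ≈⟨ ∑-distribˡ (upWeight afterD) _ (antidiagonal m) ⟩
      upWeight afterD * ∑[ (i , j) ← antidiagonal m ] (dyckSum f i false * dyckSum f j true) ∎

    dyckSum-afterD : ∀ f m → a * dyckSum (suc f) (suc m) true ≈ b * dyckSum (suc f) (suc m) false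
    dyckSum-afterD f m = begin
      a * dyckSum (suc f) (suc m) true  ≈⟨ *-congˡ (dyckSum-suc f m true) ⟩
      a * (b * X)                       ≈⟨ x∙yz≈y∙xz a b X ⟩
      b * (a * X)                       ≈⟨ *-congˡ (dyckSum-suc f m false) ⟨
      b * dyckSum (suc f) (suc m) false ∎
      where X = ∑[ (i , j) ← antidiagonal m ] (dyckSum f i false * dyckSum f j true)

    cV≈dyckSum : ∀ m (DP : Enumeration (DyckPath (suc m))) →
      cV R (suc m) DP a b ≈ dyckSum (suc m) m false
    cV≈dyckSum m DP = trans
      (∑-cong (elems DP) (λ {p} _ → pathWeight-monomial false p))
      (∑-enumeration DP (pathWeight false) (dyckPaths-sound (suc m) m)
        (dyckPaths-complete (suc m) m (ℕ.n<1+n m)) (dyckPaths-unique (suc m) m))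

  ^-zeroˡ : ∀ n → 1# ^ n ≈ 1#
  ^-zeroˡ zero    = refl
  ^-zeroˡ (suc n) = trans (*-identityˡ _) (^-zeroˡ n)

  module TreeWeight (a c : Carrier) where

    monomial : ℕ → ℕ → Carrier
    monomial i e = a ^ i * c ^ e

    monomial-+ : ∀ i i′ e e′ → monomial (i ℕ.+ i′) (e ℕ.+ e′) ≈ monomial i e * monomial i′ e′
    monomial-+ i i′ e e′ = trans (*-cong (^-homo-* a i i′) (^-homo-* c e e′)) (*-interchange _ _ _ _)

    treeWeight : Tree → Carrier
    treeWeight t = monomial (internal t) (excess t)

    treeWeight-pair : ∀ t r → treeWeight (node (t ∷ r ∷ [])) ≈ a * (treeWeight t * treeWeight r)
    treeWeight-pair t r = begin
      monomial (suc (internal t ℕ.+ (internal r ℕ.+ 0))) (excess t ℕ.+ (excess r ℕ.+ 0) ℕ.+ 0)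
        ≡⟨ ≡.cong₂ monomial (≡.cong (λ k → suc (internal t ℕ.+ k)) (ℕ.+-identityʳ _))
             (≡.trans (ℕ.+-identityʳ _) (≡.cong (excess t ℕ.+_) (ℕ.+-identityʳ _))) ⟩
      a * a ^ (internal t ℕ.+ internal r) * c ^ (excess t ℕ.+ excess r)
        ≈⟨ *-assoc _ _ _ ⟩
      a * monomial (internal t ℕ.+ internal r) (excess t ℕ.+ excess r)
        ≈⟨ *-congˡ (monomial-+ (internal t) (internal r) (excess t) (excess r)) ⟩
      a * (treeWeight t * treeWeight r) ∎

    treeWeight-merge : ∀ t x y ys →
      treeWeight (node (t ∷ x ∷ y ∷ ys)) ≈ c * (treeWeight t * treeWeight (node (x ∷ y ∷ ys)))
    treeWeight-merge t x y ys = begin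
      monomial (suc (internal t ℕ.+ IF)) (excess t ℕ.+ EF ℕ.+ suc (length ys))
        ≡⟨ ≡.cong₂ monomial (≡.sym (ℕ.+-suc (internal t) IF)) (shuffle (excess t) EF (length ys)) ⟩
      a ^ (internal t ℕ.+ suc IF) * (c * c ^ (excess t ℕ.+ (EF ℕ.+ length ys)))
        ≈⟨ x∙yz≈y∙xz _ _ _ ⟩
      c * monomial (internal t ℕ.+ suc IF) (excess t ℕ.+ (EF ℕ.+ length ys))
        ≈⟨ *-congˡ (monomial-+ (internal t) (suc IF) (excess t) (EF ℕ.+ length ys)) ⟩
      c * (treeWeight t * treeWeight (node (x ∷ y ∷ ys))) ∎
      where
      IF = internalF (x ∷ y ∷ ys)
      EF = excessF (x ∷ y ∷ ys)
      shuffle : ∀ e e′ l → e ℕ.+ e′ ℕ.+ suc l ≡ suc (e ℕ.+ (e′ ℕ.+ l))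
      shuffle = solve-∀

    branchFactor : Tree → Carrier
    branchFactor (node (_ ∷ _ ∷ _)) = a + c
    branchFactor _                  = a

    ∑-graft : ∀ t r → ∑ (graft t r) treeWeight ≈ treeWeight t * (branchFactor r * treeWeight r)
    ∑-graft t r@(node [])       = trans (+-identityʳ _) (trans (treeWeight-pair t r) (x∙yz≈y∙xz _ _ _))
    ∑-graft t r@(node (_ ∷ [])) = trans (+-identityʳ _) (trans (treeWeight-pair t r) (x∙yz≈y∙xz _ _ _))
    ∑-graft t r@(node (x ∷ y ∷ ys)) = begin
      treeWeight (node (t ∷ r ∷ [])) + (treeWeight (node (t ∷ x ∷ y ∷ ys)) + 0#)
        ≈⟨ +-cong (treeWeight-pair t r) (trans (+-identityʳ _) (treeWeight-merge t x y ys)) ⟩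
      a * (treeWeight t * treeWeight r) + c * (treeWeight t * treeWeight r)
        ≈⟨ distribʳ _ a c ⟨
      (a + c) * (treeWeight t * treeWeight r)
        ≈⟨ x∙yz≈y∙xz _ _ _ ⟩
      treeWeight t * ((a + c) * treeWeight r) ∎

    treeSum : ℕ → ℕ → Carrier
    treeSum f m = ∑ (schroederTrees f m) treeWeight

    branchSum : ℕ → ℕ → Carrier
    branchSum f m = ∑[ r ← schroederTrees f m ] (branchFactor r * treeWeight r)

    treeSum-suc : ∀ f m → treeSum (suc f) (suc m) ≈
      ∑[ (i , j) ← antidiagonal m ] (treeSum f i * branchSum f j)
    treeSum-suc f m = ∑-convolve treeWeight (schroederTrees f) (schroederTrees f) graft
      treeWeight (λ r → branchFactor r * treeWeight r) ∑-graft m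

    branchSum-zero : ∀ f → branchSum f 0 ≈ a
    branchSum-zero f = trans (+-identityʳ _) (trans (*-congˡ (*-identityˡ 1#)) (*-identityʳ a))

    branchFactor-internal : ∀ {m r} → SchroederTree (suc (suc m)) r → branchFactor r ≡ a + c
    branchFactor-internal {r = node (_ ∷ _ ∷ _)} _ = ≡.refl

    branchSum-suc : ∀ f m → branchSum f (suc m) ≈ (a + c) * treeSum f (suc m)
    branchSum-suc f m = trans
      (∑-cong (schroederTrees f (suc m))
        (λ {r} r∈ → *-congʳ (reflexive
          (branchFactor-internal {r = r} (schroederTrees-sound f (suc m) r∈)))))
      (∑-distribˡ (a + c) treeWeight (schroederTrees f (suc m)))

    treeWeight-normalise : ∀ {w} → w * c ≈ 1# → ∀ t {m} → internal t ℕ.+ excess t ≡ m →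
      c ^ m * (a * w) ^ internal t ≈ treeWeight t
    treeWeight-normalise {w} w*c≈1 t ≡.refl = begin
      c ^ (i ℕ.+ e) * (a * w) ^ i         ≈⟨ *-cong (^-homo-* c i e) (^-distrib-* a w i) ⟩
      (c ^ i * c ^ e) * (a ^ i * w ^ i)   ≈⟨ *-Solver.solve 4 (λ cᵢ cₑ aᵢ wᵢ →
                                               (cᵢ ⊕ cₑ) ⊕ (aᵢ ⊕ wᵢ) ⊜ (aᵢ ⊕ cₑ) ⊕ (wᵢ ⊕ cᵢ))
                                               refl (c ^ i) (c ^ e) (a ^ i) (w ^ i) ⟩
      treeWeight t * (w ^ i * c ^ i)       ≈⟨ *-congˡ (^-distrib-* w c i) ⟨
      treeWeight t * (w * c) ^ i           ≈⟨ *-congˡ (trans (^-congˡ i w*c≈1) (^-zeroˡ i)) ⟩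
      treeWeight t * 1#                    ≈⟨ *-identityʳ _ ⟩
      treeWeight t                         ∎
      where
      open *-Solver using (_⊕_; _⊜_)
      i = internal t
      e = excess t

    sd≈treeSum : ∀ {w} → w * c ≈ 1# → ∀ m (ST : Enumeration (SchroederTree (suc m))) →
      c ^ m * sd R (suc m) ST (a * w) ≈ treeSum (suc m) m
    sd≈treeSum {w} w*c≈1 m ST = begin
      c ^ m * sd R (suc m) ST (a * w)
        ≈⟨ *-congˡ (∑-count internal ((a * w) ^_) (upTo (suc m)) (Unique.upTo⁺ (suc m)) (elems ST)
             (All.tabulate λ t∈ → ∈-upTo⁺ (s≤s (+≡⇒≤ˡ (internal+excess≡m t∈))))) ⟩
      c ^ m * ∑[ t ← elems ST ] ((a * w) ^ internal t)
        ≈⟨ ∑-distribˡ _ _ (elems ST) ⟨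
      ∑[ t ← elems ST ] (c ^ m * (a * w) ^ internal t)
        ≈⟨ ∑-cong (elems ST) (λ {t} t∈ → treeWeight-normalise w*c≈1 t (internal+excess≡m t∈)) ⟩
      ∑ (elems ST) treeWeight
        ≈⟨ ∑-enumeration ST treeWeight (schroederTrees-sound (suc m) m)
             (schroederTrees-complete (suc m) m (ℕ.n<1+n m)) (schroederTrees-unique (suc m) m) ⟩
      treeSum (suc m) m ∎
      where
      internal+excess≡m : ∀ {t} → t ∈ elems ST → internal t ℕ.+ excess t ≡ m
      internal+excess≡m {t} t∈ = let ht , lt = All.lookup (sound ST) t∈ in
        ℕ.suc-injective (≡.trans (leaves-internal-excess t ht) lt)

  module _ (a b c : Carrier) (a+c≈b : a + c ≈ b) where
    open DyckWeight a b
    open TreeWeight a c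

    branchSum≈dyckSum : ∀ f → (∀ m → m < f → treeSum f m ≈ dyckSum f m false) →
      ∀ j → j < f → branchSum f j ≈ a * dyckSum f j true
    branchSum≈dyckSum f _ zero _ =
      trans (branchSum-zero f) (sym (trans (*-congˡ (+-identityʳ 1#)) (*-identityʳ a)))
    branchSum≈dyckSum (suc f) treeSum≈ (suc j) j<f = begin
      branchSum (suc f) (suc j)          ≈⟨ branchSum-suc (suc f) j ⟩
      (a + c) * treeSum (suc f) (suc j)  ≈⟨ *-cong a+c≈b (treeSum≈ (suc j) j<f) ⟩
      b * dyckSum (suc f) (suc j) false  ≈⟨ dyckSum-afterD f j ⟨
      a * dyckSum (suc f) (suc j) true   ∎

    treeSum≈dyckSum : ∀ f m → m < f → treeSum f m ≈ dyckSum f m false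
    treeSum≈dyckSum (suc f) zero    _         = +-congʳ (*-identityˡ 1#)
    treeSum≈dyckSum (suc f) (suc m) (s≤s m<f) = begin
      treeSum (suc f) (suc m)
        ≈⟨ treeSum-suc f m ⟩
      ∑[ (i , j) ← antidiagonal m ] (treeSum f i * branchSum f j)
        ≈⟨ ∑-cong (antidiagonal m) term ⟩
      ∑[ (i , j) ← antidiagonal m ] (a * (dyckSum f i false * dyckSum f j true))
        ≈⟨ ∑-distribˡ a _ (antidiagonal m) ⟩
      a * ∑[ (i , j) ← antidiagonal m ] (dyckSum f i false * dyckSum f j true)
        ≈⟨ dyckSum-suc f m false ⟨
      dyckSum (suc f) (suc m) false ∎
      where
      term : ∀ {(i , j) : ℕ × ℕ} → (i , j) ∈ antidiagonal m →
        treeSum f i * branchSum f j ≈ a * (dyckSum f i false * dyckSum f j true)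
      term {i , j} ij∈ = trans
        (*-cong (treeSum≈dyckSum f i (ℕ.≤-<-trans (+≡⇒≤ˡ i+j≡m) m<f))
                (branchSum≈dyckSum f (treeSum≈dyckSum f) j (ℕ.≤-<-trans (+≡⇒≤ʳ {i} i+j≡m) m<f)))
        (x∙yz≈y∙xz _ a _)
        where i+j≡m = ∈-antidiagonal⁻ {i} {j} ij∈

corollary10 : ∀ {c ℓ} (R : CommutativeRing c ℓ) →
    let open CommutativeRing R in
    (n : ℕ) → 1 ≤ n →
    (ST : Enumeration (SchroederTree n)) (DP : Enumeration (DyckPath n)) →
    (a b w : Carrier) → w * (b - a) ≈ 1# →
    cV R n DP a b ≈ pow R (b - a) (n ∸ 1) * sd R n ST (a * w)
corollary10 R (suc m) _ ST DP a b w w*[b-a]≈1 = begin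
  cV R (suc m) DP a b
    ≈⟨ cV≈dyckSum m DP ⟩
  dyckSum (suc m) m false
    ≈⟨ treeSum≈dyckSum a b (b - a) a+[b-a]≈b (suc m) m (ℕ.n<1+n m) ⟨
  treeSum (suc m) m
    ≈⟨ sd≈treeSum w*[b-a]≈1 m ST ⟨
  pow R (b - a) m * sd R (suc m) ST (a * w) ∎
  where
  open CommutativeRing R
  open WeightedSums R
  open DyckWeight a b
  open TreeWeight a (b - a)
  open import Algebra.Properties.AbelianGroup +-abelianGroup using (xyx⁻¹≈y)
  open import Relation.Binary.Reasoning.Setoid setoid

  a+[b-a]≈b : a + (b - a) ≈ b
  a+[b-a]≈b = trans (sym (+-assoc a b (- a))) (xyx⁻¹≈y a b)
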